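{- Let $k\ge 1$ be an integer and let $G$ be a $k$-uniform hypergraph with $n$ vertices and $m$ edges. Then $$\binom{n}{\alpha(G)+1}\le m\binom{n}{\alpha(G)-k+1}.$$
   Context: A $k$-uniform hypergraph $G$ consists of a finite vertex set $V(G)$ and a set $E(G)$ of $k$-element subsets of $V(G)$ (the edges). An independent set of $G$ is a subset $S\subseteq V(G)$ that contains no edge of $G$. The independence number $\alpha(G)$ is the largest cardinality of an independent set of $G$. Binomial coefficients $\binom{a}{b}$ are $0$ when $b<0$ or $b>a$. -}

module Defs where

open import Data.Nat using (ℕ; _+_; _∸_; _≤_; _≤?_)
open import Data.Nat.Combinatorics using (_C_)
open import Data.Fin.Subset using (Subset; _⊆_; ∣_∣)
open import Data.List using (List)
open import Data.List.Relation.Unary.All using (All)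
open import Data.List.Relation.Unary.Unique.Propositional using (Unique)
open import Data.Product using (Σ; _×_)
open import Relation.Binary.PropositionalEquality using (_≡_)
open import Relation.Nullary using (¬_; yes; no)

record Hypergraph (k n : ℕ) : Set where
  field
    edges   : List (Subset n)
    unique  : Unique edges
    uniform : All (λ e → ∣ e ∣ ≡ k) edges
open Hypergraph public

Independent : ∀ {k n} → Hypergraph k n → Subset n → Set
Independent G S = All (λ e → ¬ (e ⊆ S)) (edges G)

IsIndependenceNumber : ∀ {k n} → Hypergraph k n → ℕ → Set
IsIndependenceNumber {n = n} G a =
  (Σ (Subset n) λ S → Independent G S × ∣ S ∣ ≡ a)
  × (∀ S → Independent G S → ∣ S ∣ ≤ a)

-- binom n (a + 1 - k) with integer-valued lower index, 0 when a + 1 - k < 0.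
binomShift : ℕ → ℕ → ℕ → ℕ
binomShift n a k with k ≤? a + 1
... | yes _ = n C (a + 1 ∸ k)
... | no  _ = 0

{-# OPTIONS --safe #-}
-- Double count the pairs (T, e) of an (α+1)-set T and an edge e ⊆ T.  Every (α+1)-set is
-- dependent, so it lies in at least one pair; an edge e lies in C(n−k, α+1−k) ≤ C(n, α+1−k)
-- pairs, since T is determined by T ∖ e.  If k > α+1 no edge fits into an (α+1)-set, so there
-- are no (α+1)-sets at all.
module Submission where

open import Defs
open import Data.Nat using (ℕ; _+_; _*_; _≤_)
open import Data.Nat.Combinatorics using (_C_)
open import Data.List using (length)

open import Algebra.Properties.CommutativeSemigroup using (interchange)
open import Data.Bool.Base using (if_then_else_)
open import Data.Fin.Subset using (Subset; inside; outside; _⊆_; _─_; ∣_∣)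
open import Data.Fin.Subset.Properties using (_⊆?_; drop-∷-⊆; p⊆q⇒∣p∣≤∣q∣; ∣p∣≤n)
open import Data.List using (List; []; _∷_; map)
open import Data.List.Relation.Unary.All as All using (All; []; _∷_)
open import Data.List.Relation.Unary.All.Properties using (¬All⇒Any¬)
open import Data.List.Relation.Unary.Any as Any using (Any; here; there)
open import Data.Nat using (zero; suc; _∸_; _<_; _≟_; _≤?_; z≤n; _≤′_; ≤′-refl; ≤′-step)
open import Data.Nat.Combinatorics using (nCk+nC[k+1]≡[n+1]C[k+1])
open import Data.Nat.ListAction using (sum)
open import Data.Nat.Properties
open import Data.Product using (_×_; _,_)
open import Data.Vec.Base as Vec using ([]; _∷_)
open import Function using (_∘_; _⇔_; mk⇔; Equivalence)
open import Relation.Binary.PropositionalEquality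
open import Relation.Nullary using (Dec; yes; no; does; ¬_; ¬?; _×-dec_; contradiction)
open import Relation.Nullary.Decidable using (decidable-stable)
open import Relation.Unary using (Decidable)

𝟙 : ∀ {p} {P : Set p} → Dec P → ℕ
𝟙 P? = if does P? then 1 else 0

𝟙-yes : ∀ {p} {P : Set p} (P? : Dec P) → P → 𝟙 P? ≡ 1
𝟙-yes (yes _) _  = refl
𝟙-yes (no ¬p) p = contradiction p ¬p

𝟙-no : ∀ {p} {P : Set p} (P? : Dec P) → ¬ P → 𝟙 P? ≡ 0
𝟙-no (yes p) ¬p = contradiction p ¬p
𝟙-no (no _)  _  = refl

𝟙-≤ : ∀ {p} {P : Set p} {m} (P? : Dec P) → (P → 1 ≤ m) → 𝟙 P? ≤ m
𝟙-≤ (yes p) 1≤m = 1≤m p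
𝟙-≤ (no _)  _   = z≤n

𝟙-cong : ∀ {p q} {P : Set p} {Q : Set q} (P? : Dec P) (Q? : Dec Q) → P ⇔ Q → 𝟙 P? ≡ 𝟙 Q?
𝟙-cong P? Q? P⇔Q with Q?
... | yes q = 𝟙-yes P? (Equivalence.from P⇔Q q)
... | no ¬q = 𝟙-no P? (¬q ∘ Equivalence.to P⇔Q)

module _ {a p} {A : Set a} {P : A → Set p} (P? : Decidable P) where

  Any⇒1≤sum-𝟙 : ∀ {xs} → Any P xs → 1 ≤ sum (map (𝟙 ∘ P?) xs)
  Any⇒1≤sum-𝟙 {x ∷ _} (here px) = ≤-trans (≤-reflexive (sym (𝟙-yes (P? x) px))) (m≤m+n _ _)
  Any⇒1≤sum-𝟙 {x ∷ _} (there pxs) = ≤-trans (Any⇒1≤sum-𝟙 pxs) (m≤n+m _ _)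

sum-map-≤ : ∀ {a} {A : Set a} {f : A → ℕ} {c} {xs : List A} →
            All (λ x → f x ≤ c) xs → sum (map f xs) ≤ length xs * c
sum-map-≤ []           = z≤n
sum-map-≤ (fx≤c ∷ f≤c) = +-mono-≤ fx≤c (sum-map-≤ f≤c)

nCk≤[1+n]Ck : ∀ n k → n C k ≤ suc n C k
nCk≤[1+n]Ck n zero    = ≤-refl
nCk≤[1+n]Ck n (suc k) = subst (n C suc k ≤_) (nCk+nC[k+1]≡[n+1]C[k+1] n k) (m≤n+m _ _)

C-monoˡ-≤ : ∀ {m n} k → m ≤ n → m C k ≤ n C k
C-monoˡ-≤ k m≤n = go (≤⇒≤′ m≤n)
  where
  go : ∀ {m n} → m ≤′ n → m C k ≤ n C k
  go ≤′-refl                = ≤-refl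
  go (≤′-step {n = n} m≤′n) = ≤-trans (go m≤′n) (nCk≤[1+n]Ck n k)

∣q∣≡∣p∣+∣q─p∣ : ∀ {n} {p q : Subset n} → p ⊆ q → ∣ q ∣ ≡ ∣ p ∣ + ∣ q ─ p ∣
∣q∣≡∣p∣+∣q─p∣ {p = []}          {[]}          _   = refl
∣q∣≡∣p∣+∣q─p∣ {p = inside  ∷ p} {inside  ∷ q} p⊆q = cong suc (∣q∣≡∣p∣+∣q─p∣ (drop-∷-⊆ p⊆q))
∣q∣≡∣p∣+∣q─p∣ {p = inside  ∷ p} {outside ∷ q} p⊆q = contradiction (p⊆q Vec.here) λ ()
∣q∣≡∣p∣+∣q─p∣ {p = outside ∷ p} {inside  ∷ q} p⊆q =
  trans (cong suc (∣q∣≡∣p∣+∣q─p∣ (drop-∷-⊆ p⊆q))) (sym (+-suc _ _))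
∣q∣≡∣p∣+∣q─p∣ {p = outside ∷ p} {outside ∷ q} p⊆q = ∣q∣≡∣p∣+∣q─p∣ (drop-∷-⊆ p⊆q)

∑ : ∀ n → (Subset n → ℕ) → ℕ
∑ zero    f = f []
∑ (suc n) f = ∑ n (f ∘ (inside ∷_)) + ∑ n (f ∘ (outside ∷_))

∑-cong : ∀ n {f g : Subset n → ℕ} → (∀ T → f T ≡ g T) → ∑ n f ≡ ∑ n g
∑-cong zero    f≡g = f≡g []
∑-cong (suc n) f≡g = cong₂ _+_ (∑-cong n (f≡g ∘ (inside ∷_))) (∑-cong n (f≡g ∘ (outside ∷_)))

∑-mono-≤ : ∀ n {f g : Subset n → ℕ} → (∀ T → f T ≤ g T) → ∑ n f ≤ ∑ n g
∑-mono-≤ zero    f≤g = f≤g []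
∑-mono-≤ (suc n) f≤g = +-mono-≤ (∑-mono-≤ n (f≤g ∘ (inside ∷_))) (∑-mono-≤ n (f≤g ∘ (outside ∷_)))

∑-zero : ∀ n {f : Subset n → ℕ} → (∀ T → f T ≡ 0) → ∑ n f ≡ 0
∑-zero zero    f≡0 = f≡0 []
∑-zero (suc n) f≡0 = cong₂ _+_ (∑-zero n (f≡0 ∘ (inside ∷_))) (∑-zero n (f≡0 ∘ (outside ∷_)))

∑-distrib-+ : ∀ n (f g : Subset n → ℕ) → ∑ n (λ T → f T + g T) ≡ ∑ n f + ∑ n g
∑-distrib-+ zero    f g = refl
∑-distrib-+ (suc n) f g =
  trans (cong₂ _+_ (∑-distrib-+ n (f ∘ (inside ∷_)) (g ∘ (inside ∷_)))
                   (∑-distrib-+ n (f ∘ (outside ∷_)) (g ∘ (outside ∷_))))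
        (interchange +-commutativeSemigroup (∑ n (f ∘ (inside ∷_))) (∑ n (g ∘ (inside ∷_)))
                     (∑ n (f ∘ (outside ∷_))) (∑ n (g ∘ (outside ∷_))))

∑-sum-map : ∀ {a} {A : Set a} n (f : A → Subset n → ℕ) (xs : List A) →
            ∑ n (λ T → sum (map (λ x → f x T) xs)) ≡ sum (map (λ x → ∑ n (f x)) xs)
∑-sum-map n f []       = ∑-zero n (λ _ → refl)
∑-sum-map n f (x ∷ xs) = trans (∑-distrib-+ n (f x) _) (cong (∑ n (f x) +_) (∑-sum-map n f xs))

∑-size : ∀ n r → ∑ n (λ T → 𝟙 (∣ T ∣ ≟ r)) ≡ n C r
∑-size zero    zero    = refl
∑-size zero    (suc r) = refl
∑-size (suc n) zero    = cong₂ _+_ (∑-zero n (λ _ → refl)) (∑-size n zero)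
∑-size (suc n) (suc r) =
  trans (cong₂ _+_ (∑-size n r) (∑-size n (suc r))) (nCk+nC[k+1]≡[n+1]C[k+1] n r)

∑-supersets : ∀ {n} (e : Subset n) j → ∑ n (λ T → 𝟙 (e ⊆? T ×-dec ∣ T ─ e ∣ ≟ j)) ≡ (n ∸ ∣ e ∣) C j
∑-supersets []            zero    = refl
∑-supersets []            (suc j) = refl
∑-supersets {suc n} (inside ∷ e) j =
  trans (cong₂ _+_ (∑-supersets e j) (∑-zero n λ T →
           𝟙-no (inside ∷ e ⊆? outside ∷ T ×-dec ∣ T ─ e ∣ ≟ j) λ (e⊆T , _) → contradiction (e⊆T Vec.here) λ ()))
        (+-identityʳ _)
∑-supersets {suc n} (outside ∷ e) zero =
  cong₂ _+_ (∑-zero n λ T → 𝟙-no (e ⊆? T ×-dec suc ∣ T ─ e ∣ ≟ 0) λ ()) (∑-supersets e zero)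
∑-supersets {suc n} (outside ∷ e) (suc j) = begin
  ∑ n (λ T → 𝟙 (e ⊆? T ×-dec ∣ T ─ e ∣ ≟ j)) + ∑ n (λ T → 𝟙 (e ⊆? T ×-dec ∣ T ─ e ∣ ≟ suc j))
    ≡⟨ cong₂ _+_ (∑-supersets e j) (∑-supersets e (suc j)) ⟩
  (n ∸ ∣ e ∣) C j + (n ∸ ∣ e ∣) C suc j
    ≡⟨ nCk+nC[k+1]≡[n+1]C[k+1] (n ∸ ∣ e ∣) j ⟩
  suc (n ∸ ∣ e ∣) C suc j
    ≡⟨ cong (_C suc j) (+-∸-assoc 1 (∣p∣≤n e)) ⟨
  (suc n ∸ ∣ e ∣) C suc j ∎
  where open ≡-Reasoning

∑-supersets-of-size≤binomShift : ∀ {n} (e : Subset n) a →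
  ∑ n (λ T → 𝟙 (∣ T ∣ ≟ a + 1 ×-dec e ⊆? T)) ≤ binomShift n a ∣ e ∣
∑-supersets-of-size≤binomShift {n} e a with ∣ e ∣ ≤? a + 1
... | yes ∣e∣≤a+1 = begin
  ∑ n (λ T → 𝟙 (∣ T ∣ ≟ a + 1 ×-dec e ⊆? T))
    ≡⟨ ∑-cong n (λ T → 𝟙-cong (∣ T ∣ ≟ a + 1 ×-dec e ⊆? T) (e ⊆? T ×-dec ∣ T ─ e ∣ ≟ j) (equiv T)) ⟩
  ∑ n (λ T → 𝟙 (e ⊆? T ×-dec ∣ T ─ e ∣ ≟ j))
    ≡⟨ ∑-supersets e j ⟩
  (n ∸ ∣ e ∣) C j
    ≤⟨ C-monoˡ-≤ j (m∸n≤m n ∣ e ∣) ⟩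
  n C j ∎
  where
  open ≤-Reasoning
  j = a + 1 ∸ ∣ e ∣
  equiv : ∀ T → (∣ T ∣ ≡ a + 1 × e ⊆ T) ⇔ (e ⊆ T × ∣ T ─ e ∣ ≡ j)
  equiv T = mk⇔
    (λ (∣T∣≡a+1 , e⊆T) → e⊆T , (begin-equality
      ∣ T ─ e ∣               ≡⟨ m+n∸m≡n ∣ e ∣ ∣ T ─ e ∣ ⟨
      ∣ e ∣ + ∣ T ─ e ∣ ∸ ∣ e ∣ ≡⟨ cong (_∸ ∣ e ∣) (∣q∣≡∣p∣+∣q─p∣ e⊆T) ⟨
      ∣ T ∣ ∸ ∣ e ∣           ≡⟨ cong (_∸ ∣ e ∣) ∣T∣≡a+1 ⟩
      j                       ∎))
    (λ (e⊆T , ∣T─e∣≡j) → (begin-equality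
      ∣ T ∣             ≡⟨ ∣q∣≡∣p∣+∣q─p∣ e⊆T ⟩
      ∣ e ∣ + ∣ T ─ e ∣ ≡⟨ cong (∣ e ∣ +_) ∣T─e∣≡j ⟩
      ∣ e ∣ + j         ≡⟨ m+[n∸m]≡n ∣e∣≤a+1 ⟩
      a + 1             ∎) , e⊆T)
... | no ∣e∣≰a+1 = ≤-reflexive (∑-zero n λ T →
  𝟙-no (∣ T ∣ ≟ a + 1 ×-dec e ⊆? T) λ (∣T∣≡a+1 , e⊆T) →
    ∣e∣≰a+1 (subst (∣ e ∣ ≤_) ∣T∣≡a+1 (p⊆q⇒∣p∣≤∣q∣ e⊆T)))

a<∣T∣⇒Any⊆T : ∀ {k n a} (G : Hypergraph k n) → (∀ S → Independent G S → ∣ S ∣ ≤ a) →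
               ∀ T → a < ∣ T ∣ → Any (_⊆ T) (edges G)
a<∣T∣⇒Any⊆T G maximal T a<∣T∣ =
  Any.map (decidable-stable (_ ⊆? T))
    (¬All⇒Any¬ (λ e → ¬? (e ⊆? T)) (edges G) λ T-indep → <⇒≱ a<∣T∣ (maximal T T-indep))

lemma1 : (k n : ℕ) → 1 ≤ k → (G : Hypergraph k n) → (a : ℕ) → IsIndependenceNumber G a →
    n C (a + 1) ≤ length (edges G) * binomShift n a k
lemma1 k n _ G a (_ , maximal) = begin
  n C (a + 1)
    ≡⟨ ∑-size n (a + 1) ⟨
  ∑ n (λ T → 𝟙 (∣ T ∣ ≟ a + 1))
    ≤⟨ ∑-mono-≤ n [∣T∣≡a+1]≤#edges⊆T ⟩
  ∑ n (λ T → sum (map (λ e → 𝟙 (∣ T ∣ ≟ a + 1 ×-dec e ⊆? T)) (edges G)))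
    ≡⟨ ∑-sum-map n (λ e T → 𝟙 (∣ T ∣ ≟ a + 1 ×-dec e ⊆? T)) (edges G) ⟩
  sum (map (λ e → ∑ n (λ T → 𝟙 (∣ T ∣ ≟ a + 1 ×-dec e ⊆? T))) (edges G))
    ≤⟨ sum-map-≤ (All.map (λ {e} ∣e∣≡k →
         ≤-trans (∑-supersets-of-size≤binomShift e a) (≤-reflexive (cong (binomShift n a) ∣e∣≡k))) (uniform G)) ⟩
  length (edges G) * binomShift n a k ∎
  where
  open ≤-Reasoning
  [∣T∣≡a+1]≤#edges⊆T : ∀ T →
    𝟙 (∣ T ∣ ≟ a + 1) ≤ sum (map (λ e → 𝟙 (∣ T ∣ ≟ a + 1 ×-dec e ⊆? T)) (edges G))
  [∣T∣≡a+1]≤#edges⊆T T = 𝟙-≤ (∣ T ∣ ≟ a + 1) λ ∣T∣≡a+1 →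
    Any⇒1≤sum-𝟙 (λ e → ∣ T ∣ ≟ a + 1 ×-dec e ⊆? T)
      (Any.map (∣T∣≡a+1 ,_) (a<∣T∣⇒Any⊆T G maximal T (≤-reflexive (trans (+-comm 1 a) (sym ∣T∣≡a+1)))))
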